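{- Let $P_1$ and $P_2$ be head-cycle-free A-Prolog programs with respective answer sets $X_1\subsetneq X_2$. Let $l$ be a literal in $X_2\setminus X_1$ and let $\Pi=\langle r_1,\dots,r_n\rangle$ be a normal proof of $l$ with respect to $X_2$ in $P_2$. Then there exists a rule $r$ in $\Pi$ such that $r\in P_2\setminus P_1$.
   Context: A literal is an atom $a$ or its classical negation $\neg a$; a context is a consistent set of literals. A regular rule $r$ has the form $l_1 \vee \dots \vee l_k \leftarrow l_{k+1},\dots,l_m, \mathrm{not}\ l_{m+1},\dots,\mathrm{not}\ l_n$ with $1\le k\le m\le n$; $\mathrm{head}(r)=\{l_1,\dots,l_k\}$, $\mathrm{pos}(r)=\{l_{k+1},\dots,l_m\}$. $r$ fires w.r.t. $X$ if $l_{k+1},\dots,l_m\in X$ and $l_{m+1},\dots,l_n\notin X$; $X$ satisfies $r$ if whenever $r$ fires, $\mathrm{head}(r)\cap X\neq\emptyset$. A literal $l$ is supported by $r$ w.r.t. $X$ if $r$ fires w.r.t. $X$ and $\mathrm{head}(r)\cap X=\{l\}$. An A-Prolog program is a finite set of regular rules. For a program without default negation, $X$ is an answer set if $X$ satisfies it and no proper subset does; in general, the reduct $P^X$ removes every rule containing $\mathrm{not}\ l$ with $l\in X$ and deletes the remaining $\mathrm{not}$-literals, and $X$ is an answer set of $P$ if it is an answer set of $P^X$. The dependency graph of $P$ has the literals of $P$ as vertices and an edge from $l'$ to $l''$ iff some rule $r\in P$ has $l''\in\mathrm{head}(r)$, $l'\in\mathrm{pos}(r)$. $P$ is head-cycle-free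 if its dependency graph contains no directed cycle passing through two distinct literals that both belong to the head of a single rule of $P$. A proof of a literal $l$ w.r.t. a context $X$ in $P$ is a nonempty sequence $\langle r_1,\dots,r_n\rangle$ of pairwise distinct rules of $P$ such that: each $r_i$ supports some literal w.r.t. $X$, denoted $h_X(r_i)$; $l=h_X(r_n)$; $\mathrm{pos}(r_1)=\emptyset$; and for each $i$, every literal in $\mathrm{pos}(r_i)$ equals $h_X(r_j)$ for some $j<i$. For a head-cycle-free $P$ with answer set $X$, every literal of $X$ has a proof w.r.t. $X$ in $P$, and the rank $\rho(l)$ of $l\in X$ is the minimal length of a proof of $l$ w.r.t. $X$ in $P$. A proof $\Pi$ of a literal in $X$ w.r.t. $X$ in $P$ is normal if for each rule $r$ in $\Pi$ and each $l'\in\mathrm{pos}(r)$, $\rho(h_X(r))>\rho(l')$ (ranks taken w.r.t. $X$ in $P$). -}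

module Defs where

open import Level using (0ℓ)
open import Data.Nat using (ℕ; zero; suc; _<_)
open import Data.Fin using (Fin; fromℕ) renaming (_<_ to _<ᶠ_; zero to fzero)
open import Data.List using (List; []; _∷_)
open import Data.List.Relation.Unary.All using (All)
open import Data.List.Relation.Unary.Any using (Any)
open import Data.List.Membership.Propositional renaming (_∈_ to _∈ₗ_)
open import Data.Vec using (Vec; lookup)
open import Data.Product using (Σ; ∃; _×_)
open import Relation.Nullary using (¬_)
open import Relation.Unary using (Pred)
open import Relation.Binary.PropositionalEquality using (_≡_; _≢_)
open import Relation.Binary.Construct.Closure.Transitive using (TransClosure)

module ASP (Atom : Set) where

  -- literals: an atom a or its classical negation ¬a
  data Lit : Set where
    pos : Atom → Lit
    neg : Atom → Lit

  LitSet : Set₁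
  LitSet = Pred Lit 0ℓ

  Consistent : LitSet → Set
  Consistent X = ∀ a → ¬ (X (pos a) × X (neg a))

  -- regular rule  l₁ ∨ … ∨ lₖ ← l_{k+1},…,l_m, not l_{m+1},…, not l_n  with k ≥ 1:
  -- the head is  headFst ∷ headRest  (so it is nonempty),
  -- body⁺ = pos(r) = {l_{k+1},…,l_m},  body⁻ = {l_{m+1},…,l_n} (the default-negated literals)
  record Rule : Set where
    constructor rule
    field
      headFst  : Lit
      headRest : List Lit
      body⁺    : List Lit
      body⁻    : List Lit

    head : List Lit
    head = headFst ∷ headRest

  open Rule public

  Program : Set
  Program = List Rule

  Fires : Rule → LitSet → Set
  Fires r X = All X (body⁺ r) × All (λ l → ¬ X l) (body⁻ r)

  SatisfiesRule : LitSet → Rule → Set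
  SatisfiesRule X r = Fires r X → Any X (head r)

  Supports : Rule → LitSet → Lit → Set
  Supports r X l =
    Fires r X × l ∈ₗ head r × X l × (∀ l′ → l′ ∈ₗ head r → X l′ → l′ ≡ l)

  -- The reduct P^X: the rules of P none of whose default-negated literals is in X,
  -- with the 'not'-literals deleted.  Y satisfies P^X:
  SatisfiesReduct : Program → LitSet → LitSet → Set
  SatisfiesReduct P X Y =
    ∀ r → r ∈ₗ P → All (λ l → ¬ X l) (body⁻ r) → All Y (body⁺ r) → Any Y (head r)

  AnswerSet : Program → LitSet → Set₁
  AnswerSet P X =
    Consistent X × SatisfiesReduct P X X
    × (∀ (Y : LitSet) → Y Relation.Unary.⊂ X → ¬ SatisfiesReduct P X Y)

  DepEdge : Program → Lit → Lit → Set
  DepEdge P l′ l″ = Σ Rule λ r → r ∈ₗ P × l″ ∈ₗ head r × l′ ∈ₗ body⁺ r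

  OnCommonCycle : Program → Lit → Lit → Set
  OnCommonCycle P l₁ l₂ = TransClosure (DepEdge P) l₁ l₂ × TransClosure (DepEdge P) l₂ l₁

  HeadCycleFree : Program → Set
  HeadCycleFree P =
    ¬ (Σ Rule λ r → r ∈ₗ P × Σ Lit λ l₁ → Σ Lit λ l₂ →
         l₁ ∈ₗ head r × l₂ ∈ₗ head r × l₁ ≢ l₂ × OnCommonCycle P l₁ l₂)

  -- A proof ⟨r₁,…,r_{n+1}⟩ of l w.r.t. X in P, as a vector of length suc n
  -- (indices 0,…,n).  Since a rule supports at most one literal w.r.t. X,
  -- "l′ = h_X(r_j)" is expressed as "r_j supports l′ w.r.t. X".
  record IsProof (P : Program) (X : LitSet) (l : Lit) {n : ℕ} (Π : Vec Rule (suc n)) : Set where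
    field
      inProgram : ∀ i → lookup Π i ∈ₗ P
      distinct  : ∀ i j → lookup Π i ≡ lookup Π j → i ≡ j
      supports  : ∀ i → Σ Lit λ h → Supports (lookup Π i) X h
      concl     : Supports (lookup Π (fromℕ n)) X l
      firstPos  : body⁺ (lookup Π fzero) ≡ []
      earlier   : ∀ i l′ → l′ ∈ₗ body⁺ (lookup Π i) →
                  Σ (Fin (suc n)) λ j → j <ᶠ i × Supports (lookup Π j) X l′

  Rank : Program → LitSet → Lit → ℕ → Set
  Rank P X l k =
    (Σ ℕ λ n → Σ (Vec Rule (suc n)) λ Π → IsProof P X l Π × suc n ≡ k)
    × (∀ n (Π : Vec Rule (suc n)) → IsProof P X l Π → k Data.Nat.≤ suc n)

  IsNormalProof : (P : Program) (X : LitSet) (l : Lit) {n : ℕ} (Π : Vec Rule (suc n)) → Set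
  IsNormalProof P X l Π =
    IsProof P X l Π ×
    (∀ i h → Supports (lookup Π i) X h → ∀ l′ → l′ ∈ₗ body⁺ (lookup Π i) →
       Σ ℕ λ k → Σ ℕ λ k′ → Rank P X h k × Rank P X l′ k′ × k′ < k)

module Submission where

-- Suppose every rule of the proof Π = ⟨r₁,…,rₙ⟩ of l w.r.t. X₂
-- belonged to P₁.  Since X₁ satisfies the reduct P₁^X₁ and X₁ ⊆ X₂, we show
-- by strong induction on the position i that the literal supported by rᵢ
-- w.r.t. X₂ already lies in X₁: the positive body of rᵢ consists of
-- literals supported by earlier rules (in X₁ by induction), its negative
-- body avoids X₂ ⊇ X₁, so rᵢ fires w.r.t. X₁ and X₁ contains a head literal
-- of rᵢ; that literal is in X₂, hence it is the unique supported one.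
-- Applied to the last rule this gives l ∈ X₁, contradicting l ∉ X₁.
-- As membership of rules in P₁ is decidable (from decidable equality of
-- atoms), some rule of Π is therefore outside P₁; it lies in P₂ because Π
-- is a proof in P₂.

open import Defs
open import Data.Nat using (ℕ; suc)
open import Data.Fin using (Fin; fromℕ) renaming (_<_ to _<ᶠ_)
open import Data.Fin.Induction using (<-wellFounded)
open import Data.Fin.Properties using (all?; ¬∀⟶∃¬)
open import Data.Vec using (Vec; lookup)
open import Data.Vec.Membership.Propositional using () renaming (_∈_ to _∈ᵥ_)
open import Data.Vec.Membership.Propositional.Properties using (∈-lookup)
open import Data.List.Properties using (≡-dec)
open import Data.List.Membership.Propositional using (find) renaming (_∈_ to _∈ₗ_; _∉_ to _∉ₗ_)
import Data.List.Membership.DecPropositional as DecMembership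
open import Data.List.Relation.Unary.All as All using (All)
open import Data.Product using (Σ; _×_; _,_)
open import Data.Sum using (_⊎_; inj₁; inj₂)
open import Data.Empty using (⊥-elim)
open import Induction.WellFounded using (Acc; acc)
open import Relation.Nullary using (¬_; yes; no)
open import Relation.Unary using (_⊂_; _⊆_)
open import Relation.Binary.Definitions using (DecidableEquality)
open import Relation.Binary.PropositionalEquality using (refl; subst)

module _ {Atom : Set} where
  open ASP Atom

  -- Decidable equality of atoms lifts to literals and to rules; this makes
  -- "r ∈ P" decidable, which turns the contradiction below into a witness.
  module DecidableSyntax (_≟A_ : DecidableEquality Atom) where

    _≟L_ : DecidableEquality Lit
    pos a ≟L pos b with a ≟A b
    ... | yes refl = yes refl
    ... | no a≢b   = no λ { refl → a≢b refl }
    pos _ ≟L neg _ = no λ ()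
    neg _ ≟L pos _ = no λ ()
    neg a ≟L neg b with a ≟A b
    ... | yes refl = yes refl
    ... | no a≢b   = no λ { refl → a≢b refl }

    _≟R_ : DecidableEquality Rule
    rule h t p n ≟R rule h′ t′ p′ n′
      with h ≟L h′ | ≡-dec _≟L_ t t′ | ≡-dec _≟L_ p p′ | ≡-dec _≟L_ n n′
    ... | yes refl | yes refl | yes refl | yes refl = yes refl
    ... | no ne    | _        | _        | _        = no λ { refl → ne refl }
    ... | yes _    | no ne    | _        | _        = no λ { refl → ne refl }
    ... | yes _    | yes _    | no ne    | _        = no λ { refl → ne refl }
    ... | yes _    | yes _    | yes _    | no ne    = no λ { refl → ne refl }

    open DecMembership _≟R_ using (_∈?_)

    all-in-or-some-outside : (P : Program) {n : ℕ} (Π : Vec Rule (suc n)) →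
                             (∀ i → lookup Π i ∈ₗ P) ⊎ Σ (Fin (suc n)) λ i → lookup Π i ∉ₗ P
    all-in-or-some-outside P {n} Π with all? (λ i → lookup Π i ∈? P)
    ... | yes allIn = inj₁ allIn
    ... | no notAllIn with ¬∀⟶∃¬ (suc n) _ (λ i → lookup Π i ∈? P) notAllIn
    ...   | i , rᵢ∉P = inj₂ (i , rᵢ∉P)

  supported-in-closed : {P : Program} {X Y : LitSet} →
                        SatisfiesReduct P X X → X ⊆ Y →
                        {r : Rule} {h : Lit} → r ∈ₗ P → Supports r Y h →
                        All X (body⁺ r) → X h
  supported-in-closed {X = X} closed X⊆Y {r} r∈P ((_ , negY) , _ , _ , unique) posX
    with find (closed r r∈P negX posX)
    where
    -- negative body avoids Y ⊇ X, so r is a rule of the reduct P^X firing in X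
    negX : All (λ l → ¬ X l) (body⁻ r)
    negX = All.map (λ ∉Y ∈X → ∉Y (X⊆Y ∈X)) negY
  ... | h′ , h′∈head , h′∈X = subst X (unique h′ h′∈head (X⊆Y h′∈X)) h′∈X

  proof-within-closed : {P Q : Program} {X Y : LitSet} {l : Lit}
                        {n : ℕ} {Π : Vec Rule (suc n)} →
                        SatisfiesReduct P X X → X ⊆ Y → IsProof Q Y l Π →
                        (∀ i → lookup Π i ∈ₗ P) → X l
  proof-within-closed {X = X} {Y} {n = n} {Π} closed X⊆Y isProof allInP =
    supported-in-X (fromℕ n) (<-wellFounded (fromℕ n)) concl
    where
    open IsProof isProof

    supported-in-X : ∀ i → Acc _<ᶠ_ i → ∀ {h} → Supports (lookup Π i) Y h → X h
    supported-in-X i (acc below) sup =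
      supported-in-closed closed X⊆Y (allInP i) sup (All.tabulate body⁺-in-X)
      where
      body⁺-in-X : ∀ {l′} → l′ ∈ₗ body⁺ (lookup Π i) → X l′
      body⁺-in-X l′∈ with earlier i _ l′∈
      ... | j , j<i , supj = supported-in-X j (below j<i) supj

lemma9 : {Atom : Set} → DecidableEquality Atom →
    let open ASP Atom in
    (P₁ P₂ : Program) (X₁ X₂ : LitSet) →
    HeadCycleFree P₁ → HeadCycleFree P₂ →
    AnswerSet P₁ X₁ → AnswerSet P₂ X₂ → X₁ ⊂ X₂ →
    (l : Lit) → X₂ l → ¬ X₁ l →
    (n : ℕ) (Π : Vec Rule (suc n)) → IsNormalProof P₂ X₂ l Π →
    Σ Rule λ r → r ∈ᵥ Π × r ∈ₗ P₂ × r ∉ₗ P₁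
lemma9 _≟A_ P₁ P₂ X₁ X₂ _ _ (_ , closed₁ , _) _ (X₁⊆X₂ , _) l _ l∉X₁ n Π (isProof , _)
  with DecidableSyntax.all-in-or-some-outside _≟A_ P₁ Π
... | inj₁ allInP₁ = ⊥-elim (l∉X₁ (proof-within-closed closed₁ X₁⊆X₂ isProof allInP₁))
... | inj₂ (i , rᵢ∉P₁) =
  lookup Π i , ∈-lookup i Π , ASP.IsProof.inProgram isProof i , rᵢ∉P₁
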